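{- Let $T$ be a rooted tree (rooted at a vertex or at an edge) with leveled degree sequence $D$, and let $G(D)$ be the level greedy tree with leveled degree sequence $D$. Then $\mathrm{SO}(T)\ge\mathrm{SO}(G(D))$.
   Context: For a graph $G$, $\mathrm{SO}(G)=\sum_{uv\in E(G)}\sqrt{\deg_G(u)^2+\deg_G(v)^2}$. For a tree rooted at a vertex $r$, level $i$ is the set of vertices at distance $i-1$ from $r$; for a tree rooted at an edge $r_1r_2$, level $i$ is the set of vertices at distance $i-1$ from $\{r_1,r_2\}$ (level 1 is $\{r_1,r_2\}$). Children of $x$ are its neighbours at the next level. The leveled degree sequence is $D=(V_1,\dots,V_k)$ where $V_i=(i_{i,1}\ge i_{i,2}\ge\dots\ge i_{i,k_i})$ is the nonincreasing list of degrees at level $i$ and $k-1$ is the maximum level distance from the root. Level greedy tree $G(D)$: level 1 consists of $g^1_1,\dots,g^1_{k_1}$ ($k_1\in\{1,2\}$, joined by an edge if $k_1=2$) with $\deg g^1_j=i_{1,j}$. If level $h$ has vertices $g^h_1,\dots,g^h_{k_h}$ with $\deg g^h_j=i_{h,j}$, let $c_j$ be the number of children of $g^h_j$ (equal to $\deg g^h_j$ if $g^h_j$ is a vertex root, otherwise $\deg g^h_j-1$); the children of $g^h_1$ are $g^{h+1}_1,\dots,g^{h+1}_{c_1}$, those of $g^h_2$ are the next $c_2$ vertices, and so on, and $\deg g^{h+1}_j=i_{h+1,j}$. Thus vertices of larger degree receive children of larger degree. -}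

module Defs where

open import Data.Nat using (ℕ; zero; suc; _+_; _*_; _∸_; _≤_; _≤?_)
open import Data.List using (List; []; _∷_; [_]; length; map; take; drop; reverse; _++_)
open import Data.Bool using (if_then_else_)
open import Relation.Nullary.Decidable using (does)
open import Data.Nat using (_≡ᵇ_)
open import Data.Nat.ListAction using (sum)

-- A rooted tree is rooted either at a vertex or at an edge r₁r₂
-- (two subtrees whose tops r₁, r₂ are joined by an edge).

data Rose : Set where
  node : List Rose → Rose

data RTree : Set where
  vroot : Rose → RTree
  eroot : Rose → Rose → RTree

children : Rose → List Rose
children (node cs) = cs

-- degree of a non-root-vertex (has a parent) resp. of a top of an edge root
degN : Rose → ℕ
degN (node cs) = suc (length cs)

zipLong : List (List ℕ) → List (List ℕ) → List (List ℕ)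
zipLong [] ys = ys
zipLong (x ∷ xs) [] = x ∷ xs
zipLong (x ∷ xs) (y ∷ ys) = (x ++ y) ∷ zipLong xs ys

mutual
  levelsR : Rose → List (List ℕ)
  levelsR (node cs) = [ suc (length cs) ] ∷ levelsF cs

  levelsF : List Rose → List (List ℕ)
  levelsF [] = []
  levelsF (t ∷ ts) = zipLong (levelsR t) (levelsF ts)

insertDesc : ℕ → List ℕ → List ℕ
insertDesc x [] = x ∷ []
insertDesc x (y ∷ ys) = if does (y ≤? x) then x ∷ y ∷ ys else y ∷ insertDesc x ys

sortDesc : List ℕ → List ℕ
sortDesc [] = []
sortDesc (x ∷ xs) = insertDesc x (sortDesc xs)

levDeg : RTree → List (List ℕ)
levDeg (vroot (node cs)) = map sortDesc ([ length cs ] ∷ levelsF cs)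
levDeg (eroot a b) = map sortDesc ((degN a ∷ degN b ∷ []) ∷ zipLong (levelsF (children a)) (levelsF (children b)))

chunk : List ℕ → List Rose → List Rose
chunk [] ts = []
chunk (c ∷ cs) ts = node (take c ts) ∷ chunk cs (drop c ts)

buildLevels : List (List ℕ) → List Rose
buildLevels [] = []
buildLevels (V ∷ Vs) = chunk (map (λ d → d ∸ 1) V) (buildLevels Vs)

-- G(D); on sequences D with |V₁| ∉ {1,2} (which are not leveled degree
-- sequences of any rooted tree) it returns a dummy value
greedy : List (List ℕ) → RTree
greedy ((d ∷ []) ∷ Vs) = vroot (node (take d (buildLevels Vs)))
greedy ((d₁ ∷ d₂ ∷ []) ∷ Vs) =
  let F = buildLevels Vs in
  eroot (node (take (d₁ ∸ 1) F)) (node (take (d₂ ∸ 1) (drop (d₁ ∸ 1) F)))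
greedy _ = vroot (node [])

-- Sombor index.  We record, for every edge uv, the natural number
-- deg(u)² + deg(v)²; SO is the sum of the square roots of these.

sq : ℕ → ℕ
sq n = n * n

-- edges below the children in a forest whose parent has degree pd
edgesF : ℕ → List Rose → List ℕ
edgesF pd [] = []
edgesF pd (node cs ∷ ts) =
  (sq pd + sq (suc (length cs))) ∷ (edgesF (suc (length cs)) cs ++ edgesF pd ts)

soTerms : RTree → List ℕ
soTerms (vroot (node cs)) = edgesF (length cs) cs
soTerms (eroot (node a) (node b)) =
  (sq (suc (length a)) + sq (suc (length b)))
    ∷ (edgesF (suc (length a)) a ++ edgesF (suc (length b)) b)

floorSqrt : ℕ → ℕ
floorSqrt zero = zero
floorSqrt (suc m) with floorSqrt m
... | r = if does (sq (suc r) ≤? suc m) then suc r else r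

ceilSqrt : ℕ → ℕ
ceilSqrt m = let r = floorSqrt m in if sq r ≡ᵇ m then r else suc r

-- SqrtSumGe xs ys  means  Σ_{x∈xs} √x ≥ Σ_{y∈ys} √y  (as real numbers).
-- Encoded exactly as: for every N, Σ ⌈N√x⌉ ≥ Σ ⌊N√y⌋, with N√x = √(N²x).
-- (If the real inequality holds, this is immediate; if it fails with gap δ,
-- it fails for any N with Nδ > |xs| + |ys|.)
SqrtSumGe : List ℕ → List ℕ → Set
SqrtSumGe xs ys =
  (N : ℕ) → sum (map (λ y → floorSqrt (sq N * y)) ys) ≤ sum (map (λ x → ceilSqrt (sq N * x)) xs)

SO-≥ : RTree → RTree → Set
SO-≥ T T′ = SqrtSumGe (soTerms T) (soTerms T′)

-- The edge weight √(a² + b²) has the exchange property: for a ≤ p and b ≤ c,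
-- √(p² + b²) + √(a² + c²) ≥ √(p² + c²) + √(a² + b²), since the two pairs of radicands have
-- the same sum and (p² + b²)(a² + c²) − (p² + c²)(a² + b²) = (p² − a²)(c² − b²) ≥ 0.
-- Repeated exchanges show that the edges between two consecutive levels have the smallest
-- Sombor sum when parent and child degrees are matched in the same nonincreasing order.
-- G(D) sorts every level and gives larger vertices the larger children, so it realises this
-- matching on all levels at once; summing over the levels gives SO(T) ≥ SO(G(D)).

module Submission where

open import Data.Nat
open import Data.Nat.Properties
open import Data.Nat.Tactic.RingSolver using (solve-∀)
open import Data.Bool using (true; false; T)
open import Data.Unit using (tt)
open import Function using (_∘_)
open import Data.Sum using (_⊎_; inj₁; inj₂)
open import Data.Product using (_×_; _,_; proj₁; proj₂; ∃; ∃₂)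
open import Relation.Nullary using (yes; no; does; proof; ofʸ; ofⁿ; contradiction)
open import Relation.Binary.PropositionalEquality hiding ([_])
open import Data.List using (List; []; _∷_; [_]; _++_; map; length; concatMap; replicate; take; drop)
import Data.List.Properties as List
open import Data.List.Properties using (map-++)
import Data.List.Relation.Binary.Permutation.Propositional as ↭
open import Data.List.Relation.Binary.Permutation.Propositional
  using (_↭_; ↭-refl; ↭-sym; ↭-trans; ↭-reflexive; prep; swap; module PermutationReasoning)
open import Data.List.Relation.Binary.Permutation.Propositional.Properties
  using ( map⁺; All-resp-↭; ∈-resp-↭; drop-∷; shift; shifts; ↭-empty-inv; ↭-length
        ; ++⁺; ++⁺ˡ; ++-identityʳ; ++-comm)
open import Data.List.Relation.Unary.All using (All; []; _∷_)
import Data.List.Relation.Unary.All as All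
import Data.List.Relation.Unary.All.Properties as All
import Data.List.Relation.Unary.AllPairs as AllPairs
import Data.List.Relation.Unary.AllPairs.Properties as AllPairsₚ
open import Data.List.Relation.Unary.AllPairs using (AllPairs; []; _∷_)
open import Data.List.Relation.Unary.Any using (here; there)
open import Data.List.Membership.Propositional using (_∈_)
open import Data.List.Membership.Propositional.Properties using (∈-∃++; ∈-map⁻)
open import Data.Nat.ListAction using (sum)
open import Data.Nat.ListAction.Properties using (sum-++; sum-↭)

open import Defs

sq-cancel-≤ : ∀ {u v} → sq u ≤ sq v → u ≤ v
sq-cancel-≤ {u} {v} u²≤v² with u ≤? v
... | yes u≤v = u≤v
... | no u≰v = contradiction u²≤v² (<⇒≱ (*-mono-< (≰⇒> u≰v) (≰⇒> u≰v)))

sq-cancel-< : ∀ {u v} → sq u < sq v → u < v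
sq-cancel-< {u} {v} u²<v² with u <? v
... | yes u<v = u<v
... | no u≮v = contradiction u²<v² (≤⇒≯ (*-mono-≤ (≮⇒≥ u≮v) (≮⇒≥ u≮v)))

sq-mono-≤ : ∀ {u v} → u ≤ v → sq u ≤ sq v
sq-mono-≤ u≤v = *-mono-≤ u≤v u≤v

sq-* : ∀ m n → (m * n) * (m * n) ≡ (m * m) * (n * n)
sq-* = solve-∀

floorSqrt-suc : ∀ m → (sq (suc (floorSqrt m)) ≤ suc m × floorSqrt (suc m) ≡ suc (floorSqrt m))
                    ⊎ (sq (suc (floorSqrt m)) ≰ suc m × floorSqrt (suc m) ≡ floorSqrt m)
floorSqrt-suc m with floorSqrt m
... | r with does (sq (suc r) ≤? suc m) | proof (sq (suc r) ≤? suc m)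
...   | true | ofʸ r+1²≤m+1 = inj₁ (r+1²≤m+1 , refl)
...   | false | ofⁿ r+1²≰m+1 = inj₂ (r+1²≰m+1 , refl)

sq-floorSqrt≤ : ∀ m → sq (floorSqrt m) ≤ m
sq-floorSqrt≤ zero = z≤n
sq-floorSqrt≤ (suc m) with floorSqrt-suc m
... | inj₁ (r+1²≤m+1 , eq) rewrite eq = r+1²≤m+1
... | inj₂ (_ , eq) rewrite eq = m≤n⇒m≤1+n (sq-floorSqrt≤ m)

<-sq-suc-floorSqrt : ∀ m → m < sq (suc (floorSqrt m))
<-sq-suc-floorSqrt zero = s≤s z≤n
<-sq-suc-floorSqrt (suc m) with floorSqrt-suc m
... | inj₁ (_ , eq) rewrite eq = ≤-<-trans (<-sq-suc-floorSqrt m) (*-mono-< r+1<r+2 r+1<r+2)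
  where r+1<r+2 = n<1+n (suc (floorSqrt m))
... | inj₂ (r+1²≰m+1 , eq) rewrite eq = ≰⇒> r+1²≰m+1

floorSqrt-greatest : ∀ {u m} → sq u ≤ m → u ≤ floorSqrt m
floorSqrt-greatest {m = m} u²≤m = s≤s⁻¹ (sq-cancel-< (≤-<-trans u²≤m (<-sq-suc-floorSqrt m)))

ceilSqrt-cases : ∀ m → (sq (floorSqrt m) ≡ m × ceilSqrt m ≡ floorSqrt m)
                     ⊎ (sq (floorSqrt m) ≢ m × ceilSqrt m ≡ suc (floorSqrt m))
ceilSqrt-cases m with sq (floorSqrt m) ≡ᵇ m in eq
... | true = inj₁ (≡ᵇ⇒≡ _ _ (subst T (sym eq) tt) , refl)
... | false = inj₂ ((λ r²≡m → subst T eq (≡⇒≡ᵇ _ _ r²≡m)) , refl)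

≤-sq-ceilSqrt : ∀ m → m ≤ sq (ceilSqrt m)
≤-sq-ceilSqrt m with ceilSqrt-cases m
... | inj₁ (r²≡m , eq) rewrite eq = ≤-reflexive (sym r²≡m)
... | inj₂ (_ , eq) rewrite eq = <⇒≤ (<-sq-suc-floorSqrt m)

ceilSqrt-least : ∀ {m c} → m ≤ sq c → ceilSqrt m ≤ c
ceilSqrt-least {m} {c} m≤c² with ceilSqrt-cases m
... | inj₁ (r²≡m , eq) rewrite eq = sq-cancel-≤ (≤-trans (≤-reflexive r²≡m) m≤c²)
... | inj₂ (r²≢m , eq) rewrite eq with floorSqrt m <? c
...   | yes r<c = r<c
...   | no r≮c =
  contradiction (≤-antisym (sq-floorSqrt≤ m) (≤-trans m≤c² (sq-mono-≤ (≮⇒≥ r≮c)))) r²≢m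

ceilSqrt≤suc-floorSqrt : ∀ m → ceilSqrt m ≤ suc (floorSqrt m)
ceilSqrt≤suc-floorSqrt m = ceilSqrt-least (<⇒≤ (<-sq-suc-floorSqrt m))

floorSqrt≤ceilSqrt : ∀ m → floorSqrt m ≤ ceilSqrt m
floorSqrt≤ceilSqrt m = sq-cancel-≤ (≤-trans (sq-floorSqrt≤ m) (≤-sq-ceilSqrt m))

*-floorSqrt≤floorSqrt-sq* : ∀ k m → k * floorSqrt m ≤ floorSqrt (sq k * m)
*-floorSqrt≤floorSqrt-sq* k m = floorSqrt-greatest (begin
  sq (k * floorSqrt m)     ≡⟨ sq-* k (floorSqrt m) ⟩
  sq k * sq (floorSqrt m)  ≤⟨ *-monoʳ-≤ (sq k) (sq-floorSqrt≤ m) ⟩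
  sq k * m                 ∎)
  where open ≤-Reasoning

ceilSqrt-sq*≤*-ceilSqrt : ∀ k m → ceilSqrt (sq k * m) ≤ k * ceilSqrt m
ceilSqrt-sq*≤*-ceilSqrt k m = ceilSqrt-least (begin
  sq k * m                ≤⟨ *-monoʳ-≤ (sq k) (≤-sq-ceilSqrt m) ⟩
  sq k * sq (ceilSqrt m)  ≡⟨ sq-* k (ceilSqrt m) ⟨
  sq (k * ceilSqrt m)     ∎)
  where open ≤-Reasoning

sum-map-mono : ∀ {A : Set} {f g : A → ℕ} xs → (∀ x → f x ≤ g x) → sum (map f xs) ≤ sum (map g xs)
sum-map-mono [] f≤g = z≤n
sum-map-mono (x ∷ xs) f≤g = +-mono-≤ (f≤g x) (sum-map-mono xs f≤g)

*-sum-map : ∀ {A : Set} k (f : A → ℕ) xs → k * sum (map f xs) ≡ sum (map (λ x → k * f x) xs)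
*-sum-map k f [] = *-zeroʳ k
*-sum-map k f (x ∷ xs) = trans (*-distribˡ-+ k (f x) _) (cong (k * f x +_) (*-sum-map k f xs))

sum-map-suc : ∀ {A : Set} (f : A → ℕ) xs → sum (map (λ x → suc (f x)) xs) ≡ length xs + sum (map f xs)
sum-map-suc f [] = refl
sum-map-suc f (x ∷ xs) =
  cong suc (trans (cong (f x +_) (sum-map-suc f xs)) (x+[y+z]≡y+[x+z] (f x) (length xs) _))
  where
  x+[y+z]≡y+[x+z] : ∀ x y z → x + (y + z) ≡ y + (x + z)
  x+[y+z]≡y+[x+z] = solve-∀

sum-map-++ : ∀ {A : Set} (f : A → ℕ) xs ys → sum (map f (xs ++ ys)) ≡ sum (map f xs) + sum (map f ys)
sum-map-++ f xs ys = trans (cong sum (map-++ f xs ys)) (sum-++ (map f xs) (map f ys))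

lowerSum upperSum : ℕ → List ℕ → ℕ
lowerSum N ys = sum (map (λ y → floorSqrt (sq N * y)) ys)
upperSum N xs = sum (map (λ x → ceilSqrt (sq N * x)) xs)

infix 4 _≥√_

-- A record rather than SqrtSumGe itself, so that the two lists can be inferred from a proof.
record _≥√_ (xs ys : List ℕ) : Set where
  constructor mk≥√
  field holds : SqrtSumGe xs ys

open _≥√_

sq*-assoc : ∀ k N y → (k * N) * (k * N) * y ≡ (k * k) * ((N * N) * y)
sq*-assoc = solve-∀

lowerSum-scale : ∀ k N ys → k * lowerSum N ys ≤ lowerSum (k * N) ys
lowerSum-scale k N ys = begin
  k * lowerSum N ys                                    ≡⟨ *-sum-map k _ ys ⟩
  sum (map (λ y → k * floorSqrt (sq N * y)) ys)        ≤⟨ sum-map-mono ys scale ⟩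
  lowerSum (k * N) ys                                  ∎
  where
  open ≤-Reasoning
  scale : ∀ y → k * floorSqrt (sq N * y) ≤ floorSqrt (sq (k * N) * y)
  scale y = subst (λ m → k * floorSqrt (sq N * y) ≤ floorSqrt m) (sym (sq*-assoc k N y))
                  (*-floorSqrt≤floorSqrt-sq* k (sq N * y))

upperSum-scale : ∀ k N xs → upperSum (k * N) xs ≤ k * upperSum N xs
upperSum-scale k N xs = begin
  upperSum (k * N) xs                                  ≤⟨ sum-map-mono xs scale ⟩
  sum (map (λ x → k * ceilSqrt (sq N * x)) xs)         ≡⟨ *-sum-map k _ xs ⟨
  k * upperSum N xs                                    ∎
  where
  open ≤-Reasoning
  scale : ∀ x → ceilSqrt (sq (k * N) * x) ≤ k * ceilSqrt (sq N * x)
  scale x = subst (λ m → ceilSqrt m ≤ k * ceilSqrt (sq N * x)) (sym (sq*-assoc k N x))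
                  (ceilSqrt-sq*≤*-ceilSqrt k (sq N * x))

upperSum≤length+lowerSum : ∀ N xs → upperSum N xs ≤ length xs + lowerSum N xs
upperSum≤length+lowerSum N xs = begin
  upperSum N xs                                    ≤⟨ sum-map-mono xs (ceilSqrt≤suc-floorSqrt ∘ (sq N *_)) ⟩
  sum (map (λ x → suc (floorSqrt (sq N * x))) xs)  ≡⟨ sum-map-suc _ xs ⟩
  length xs + lowerSum N xs                        ∎
  where open ≤-Reasoning

≥√-refl : ∀ xs → xs ≥√ xs
≥√-refl xs = mk≥√ λ N → sum-map-mono xs (λ x → floorSqrt≤ceilSqrt (sq N * x))

-- Rounding at scale N errs by less than |ys|, so comparing at the finer scale (|ys| + 1) N
-- absorbs the error of passing through ys.
≥√-trans : ∀ {xs ys zs} → xs ≥√ ys → ys ≥√ zs → xs ≥√ zs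
≥√-trans {xs} {ys} {zs} (mk≥√ xs≥ys) (mk≥√ ys≥zs) = mk≥√ λ N →
  s≤s⁻¹ (*-cancelˡ-< M _ _ (begin-strict
  M * lowerSum N zs              ≤⟨ lowerSum-scale M N zs ⟩
  lowerSum (M * N) zs            ≤⟨ ys≥zs (M * N) ⟩
  upperSum (M * N) ys            ≤⟨ upperSum≤length+lowerSum (M * N) ys ⟩
  length ys + lowerSum (M * N) ys ≤⟨ +-monoʳ-≤ (length ys) (xs≥ys (M * N)) ⟩
  length ys + upperSum (M * N) xs ≤⟨ +-monoʳ-≤ (length ys) (upperSum-scale M N xs) ⟩
  length ys + M * upperSum N xs  <⟨ +-monoˡ-< (M * upperSum N xs) (n<1+n (length ys)) ⟩
  M + M * upperSum N xs          ≡⟨ *-suc M (upperSum N xs) ⟨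
  M * suc (upperSum N xs)        ∎))
  where
  open ≤-Reasoning
  M = suc (length ys)

≥√-∷ : ∀ {x y xs ys} → y ≤ x → xs ≥√ ys → x ∷ xs ≥√ y ∷ ys
≥√-∷ {x} {y} y≤x (mk≥√ xs≥ys) = mk≥√ λ N → +-mono-≤ (root-mono N) (xs≥ys N)
  where
  root-mono : ∀ N → floorSqrt (sq N * y) ≤ ceilSqrt (sq N * x)
  root-mono N = sq-cancel-≤ (≤-trans (sq-floorSqrt≤ _)
                  (≤-trans (*-monoʳ-≤ (sq N) y≤x) (≤-sq-ceilSqrt _)))

≥√-++ : ∀ {xs ys us vs} → xs ≥√ ys → us ≥√ vs → xs ++ us ≥√ ys ++ vs
≥√-++ {xs} {ys} {us} {vs} (mk≥√ xs≥ys) (mk≥√ us≥vs) = mk≥√ λ N →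
  subst₂ _≤_ (sym (sum-map-++ _ ys vs)) (sym (sum-map-++ _ xs us)) (+-mono-≤ (xs≥ys N) (us≥vs N))

≥√-resp-↭ : ∀ {xs ys xs′ ys′} → xs ↭ xs′ → ys ↭ ys′ → xs ≥√ ys → xs′ ≥√ ys′
≥√-resp-↭ xs↭xs′ ys↭ys′ (mk≥√ xs≥ys) = mk≥√ λ N →
  subst₂ _≤_ (sum-↭ (map⁺ _ ys↭ys′)) (sum-↭ (map⁺ _ xs↭xs′)) (xs≥ys N)

roots-exchange : ∀ u v c d {P Q S T} → sq u ≤ P → sq v ≤ Q → S ≤ sq c → T ≤ sq d →
                 P + Q ≡ S + T → P * Q ≤ S * T → u + v ≤ c + d
roots-exchange u v c d {P} {Q} {S} {T} u²≤P v²≤Q S≤c² T≤d² P+Q≡S+T PQ≤ST = sq-cancel-≤ (begin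
  sq (u + v)                     ≡⟨ sq-+ u v ⟩
  (sq u + sq v) + 2 * (u * v)    ≤⟨ +-mono-≤ (+-mono-≤ u²≤P v²≤Q) (*-monoʳ-≤ 2 uv≤cd) ⟩
  (P + Q) + 2 * (c * d)          ≡⟨ cong (_+ 2 * (c * d)) P+Q≡S+T ⟩
  (S + T) + 2 * (c * d)          ≤⟨ +-monoˡ-≤ (2 * (c * d)) (+-mono-≤ S≤c² T≤d²) ⟩
  (sq c + sq d) + 2 * (c * d)    ≡⟨ sq-+ c d ⟨
  sq (c + d)                     ∎)
  where
  open ≤-Reasoning
  sq-+ : ∀ a b → (a + b) * (a + b) ≡ (a * a + b * b) + 2 * (a * b)
  sq-+ = solve-∀
  uv≤cd : u * v ≤ c * d
  uv≤cd = sq-cancel-≤ (begin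
    sq (u * v)        ≡⟨ sq-* u v ⟩
    sq u * sq v       ≤⟨ *-mono-≤ u²≤P v²≤Q ⟩
    P * Q             ≤⟨ PQ≤ST ⟩
    S * T             ≤⟨ *-mono-≤ S≤c² T≤d² ⟩
    sq c * sq d       ≡⟨ sq-* c d ⟨
    sq (c * d)        ∎)

√-exchange : ∀ {p q r s} → p + q ≡ r + s → p * q ≤ r * s → r ∷ s ∷ [] ≥√ p ∷ q ∷ []
√-exchange {p} {q} {r} {s} p+q≡r+s pq≤rs = mk≥√ λ N →
  subst₂ _≤_ (cong (floorSqrt (sq N * p) +_) (sym (+-identityʳ _)))
             (cong (ceilSqrt (sq N * r) +_) (sym (+-identityʳ _)))
    (roots-exchange (floorSqrt (sq N * p)) (floorSqrt (sq N * q)) (ceilSqrt (sq N * r)) (ceilSqrt (sq N * s))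
      (sq-floorSqrt≤ (sq N * p)) (sq-floorSqrt≤ (sq N * q))
      (≤-sq-ceilSqrt (sq N * r)) (≤-sq-ceilSqrt (sq N * s)) (scale-sum N) (scale-product N))
  where
  scale-sum : ∀ N → sq N * p + sq N * q ≡ sq N * r + sq N * s
  scale-sum N = trans (sym (*-distribˡ-+ (sq N) p q))
                      (trans (cong (sq N *_) p+q≡r+s) (*-distribˡ-+ (sq N) r s))
  sq*-interchange : ∀ n a b → (n * a) * (n * b) ≡ (n * n) * (a * b)
  sq*-interchange = solve-∀
  scale-product : ∀ N → (sq N * p) * (sq N * q) ≤ (sq N * r) * (sq N * s)
  scale-product N = subst₂ _≤_ (sym (sq*-interchange (sq N) p q)) (sym (sq*-interchange (sq N) r s))
                      (*-monoʳ-≤ (sq N * sq N) pq≤rs)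

*-rearrangement : ∀ {A P B C} → A ≤ P → B ≤ C → (P + C) * (A + B) ≤ (P + B) * (A + C)
*-rearrangement {A} {B = B} A≤P B≤C with m≤n⇒∃[o]m+o≡n A≤P | m≤n⇒∃[o]m+o≡n B≤C
... | X , refl | Y , refl = subst ((A + X + (B + Y)) * (A + B) ≤_) (expand A X B Y) (m≤m+n _ (X * Y))
  where
  expand : ∀ A X B Y → (A + X + (B + Y)) * (A + B) + X * Y ≡ (A + X + B) * (A + (B + Y))
  expand = solve-∀

sombor : ℕ × ℕ → ℕ
sombor (a , b) = sq a + sq b

sombor-exchange : ∀ {p a c b} → a ≤ p → b ≤ c →
  sombor (p , b) ∷ sombor (a , c) ∷ [] ≥√ sombor (p , c) ∷ sombor (a , b) ∷ []
sombor-exchange {p} {a} {c} {b} a≤p b≤c =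
  √-exchange (interchange (sq p) (sq c) (sq a) (sq b)) (*-rearrangement (sq-mono-≤ a≤p) (sq-mono-≤ b≤c))
  where
  interchange : ∀ P C A B → (P + C) + (A + B) ≡ (P + B) + (A + C)
  interchange = solve-∀

Nonincreasing : List ℕ → Set
Nonincreasing = AllPairs _≥_

≤-head : ∀ {x y xs} → Nonincreasing (x ∷ xs) → y ∈ x ∷ xs → y ≤ x
≤-head _ (here refl) = ≤-refl
≤-head (x≥xs ∷ _) (there y∈xs) = All.lookup x≥xs y∈xs

insertDesc-↭ : ∀ x ys → insertDesc x ys ↭ x ∷ ys
insertDesc-↭ x [] = ↭-refl
insertDesc-↭ x (y ∷ ys) with does (y ≤? x)
... | true = ↭-refl
... | false = ↭-trans (prep y (insertDesc-↭ x ys)) (swap y x ↭-refl)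

sortDesc-↭ : ∀ xs → sortDesc xs ↭ xs
sortDesc-↭ [] = ↭-refl
sortDesc-↭ (x ∷ xs) = ↭-trans (insertDesc-↭ x (sortDesc xs)) (prep x (sortDesc-↭ xs))

insertDesc-nonincreasing : ∀ x {ys} → Nonincreasing ys → Nonincreasing (insertDesc x ys)
insertDesc-nonincreasing x [] = [] ∷ []
insertDesc-nonincreasing x {y ∷ ys} (y≥ys ∷ ys↓) with does (y ≤? x) | proof (y ≤? x)
... | true | ofʸ y≤x = (y≤x ∷ All.map (λ z≤y → ≤-trans z≤y y≤x) y≥ys) ∷ y≥ys ∷ ys↓
... | false | ofⁿ y≰x =
  All-resp-↭ (↭-sym (insertDesc-↭ x ys)) (<⇒≤ (≰⇒> y≰x) ∷ y≥ys)
    ∷ insertDesc-nonincreasing x ys↓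

sortDesc-nonincreasing : ∀ xs → Nonincreasing (sortDesc xs)
sortDesc-nonincreasing [] = []
sortDesc-nonincreasing (x ∷ xs) = insertDesc-nonincreasing x (sortDesc-nonincreasing xs)

Pairs : Set
Pairs = List (ℕ × ℕ)

record SortedRearrangement (Q Q′ : Pairs) : Set where
  field
    fst-↭ : map proj₁ Q ↭ map proj₁ Q′
    snd-↭ : map proj₂ Q ↭ map proj₂ Q′
    fst-nonincreasing : Nonincreasing (map proj₁ Q′)
    snd-nonincreasing : Nonincreasing (map proj₂ Q′)

open SortedRearrangement

SortedRearrangement-precompose : ∀ {R Q Q′} →
  map proj₁ R ↭ map proj₁ Q → map proj₂ R ↭ map proj₂ Q →
  SortedRearrangement Q Q′ → SortedRearrangement R Q′
SortedRearrangement-precompose R↭Q₁ R↭Q₂ r = record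
  { fst-↭ = ↭-trans R↭Q₁ (fst-↭ r) ; snd-↭ = ↭-trans R↭Q₂ (snd-↭ r)
  ; fst-nonincreasing = fst-nonincreasing r ; snd-nonincreasing = snd-nonincreasing r }

SortedRearrangement-tail : ∀ {q Q Q′} →
  SortedRearrangement (q ∷ Q) (q ∷ Q′) → SortedRearrangement Q Q′
SortedRearrangement-tail r = record
  { fst-↭ = drop-∷ (fst-↭ r) ; snd-↭ = drop-∷ (snd-↭ r)
  ; fst-nonincreasing = AllPairs.tail (fst-nonincreasing r)
  ; snd-nonincreasing = AllPairs.tail (snd-nonincreasing r) }

∈⇒↭∷ : ∀ {A : Set} {x : A} {xs} → x ∈ xs → ∃ λ rest → xs ↭ x ∷ rest
∈⇒↭∷ x∈xs with ∈-∃++ x∈xs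
... | ys , zs , refl = ys ++ zs , shift _ ys zs

∈-fst⇒↭∷ : ∀ {p Q} → p ∈ map proj₁ Q → ∃₂ λ b (rest : Pairs) → Q ↭ (p , b) ∷ rest
∈-fst⇒↭∷ p∈ with ∈-map⁻ proj₁ p∈
... | (_ , b) , pb∈Q , refl = b , ∈⇒↭∷ pb∈Q

∈-snd⇒↭∷ : ∀ {c Q} → c ∈ map proj₂ Q → ∃₂ λ a (rest : Pairs) → Q ↭ (a , c) ∷ rest
∈-snd⇒↭∷ c∈ with ∈-map⁻ proj₂ c∈
... | (a , _) , ac∈Q , refl = a , ∈⇒↭∷ ac∈Q

-- Pull the pair (p, b) whose first coordinate is the largest; if b is not the largest second
-- coordinate c, the pair (a, c) holding it is exchanged with (p, b) into (p, c), (a, b).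
sombor-rearrangement : ∀ {Q} Q′ → SortedRearrangement Q Q′ → map sombor Q ≥√ map sombor Q′
sombor-rearrangement {[]} [] _ = ≥√-refl []
sombor-rearrangement {_ ∷ _} [] r with ↭-empty-inv (fst-↭ r)
... | ()
sombor-rearrangement {Q} ((p , c) ∷ Q″) r with ∈-fst⇒↭∷ (∈-resp-↭ (↭-sym (fst-↭ r)) (here refl))
... | b , Q₁ , Q↭ = ≥√-resp-↭ (map⁺ sombor (↭-sym Q↭)) ↭-refl
  (with-head-pair (SortedRearrangement-precompose (map⁺ proj₁ (↭-sym Q↭)) (map⁺ proj₂ (↭-sym Q↭)) r))
  where
  with-head-pair : SortedRearrangement ((p , b) ∷ Q₁) ((p , c) ∷ Q″) →
                   map sombor ((p , b) ∷ Q₁) ≥√ map sombor ((p , c) ∷ Q″)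
  with-head-pair r′ with ∈-resp-↭ (↭-sym (snd-↭ r′)) (here refl)
  ... | here refl = ≥√-∷ ≤-refl (sombor-rearrangement Q″ (SortedRearrangement-tail r′))
  ... | there c∈Q₁ with ∈-snd⇒↭∷ c∈Q₁
  ...   | a , Q₂ , Q₁↭ =
    ≥√-trans exchanged (≥√-∷ ≤-refl (sombor-rearrangement Q″ (SortedRearrangement-tail r″)))
    where
    a≤p : a ≤ p
    a≤p = ≤-head (fst-nonincreasing r′)
            (∈-resp-↭ (fst-↭ r′) (there (∈-resp-↭ (map⁺ proj₁ (↭-sym Q₁↭)) (here refl))))
    b≤c : b ≤ c
    b≤c = ≤-head (snd-nonincreasing r′) (∈-resp-↭ (snd-↭ r′) (here refl))
    exchanged : map sombor ((p , b) ∷ Q₁) ≥√ map sombor ((p , c) ∷ (a , b) ∷ Q₂)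
    exchanged = ≥√-resp-↭ (map⁺ sombor (prep (p , b) (↭-sym Q₁↭))) ↭-refl
                  (≥√-++ (sombor-exchange a≤p b≤c) (≥√-refl (map sombor Q₂)))
    r″ : SortedRearrangement ((p , c) ∷ (a , b) ∷ Q₂) ((p , c) ∷ Q″)
    r″ = SortedRearrangement-precompose (prep p (map⁺ proj₁ (↭-sym Q₁↭)))
           (↭-trans (swap c b ↭-refl) (prep b (map⁺ proj₂ (↭-sym Q₁↭)))) r′

++-interchange-↭ : ∀ {A : Set} (a b c d : List A) → (a ++ b) ++ (c ++ d) ↭ (a ++ c) ++ (b ++ d)
++-interchange-↭ a b c d = begin
  (a ++ b) ++ (c ++ d)  ≡⟨ List.++-assoc a b (c ++ d) ⟩
  a ++ (b ++ (c ++ d))  ↭⟨ ++⁺ˡ a (shifts b c) ⟩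
  a ++ (c ++ (b ++ d))  ≡⟨ List.++-assoc a c (b ++ d) ⟨
  (a ++ c) ++ (b ++ d)  ∎
  where open PermutationReasoning

concatMap-↭ : ∀ {A B : Set} (f : A → List B) {xs ys} → xs ↭ ys → concatMap f xs ↭ concatMap f ys
concatMap-↭ f ↭.refl = ↭-refl
concatMap-↭ f (prep x p) = ++⁺ˡ (f x) (concatMap-↭ f p)
concatMap-↭ f (swap x y p) = ↭-trans (shifts (f x) (f y)) (++⁺ˡ (f y) (++⁺ˡ (f x) (concatMap-↭ f p)))
concatMap-↭ f (↭.trans p q) = ↭-trans (concatMap-↭ f p) (concatMap-↭ f q)

zipLevels : ∀ {A : Set} → List (List A) → List (List A) → List (List A)
zipLevels [] ys = ys
zipLevels (x ∷ xs) [] = x ∷ xs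
zipLevels (x ∷ xs) (y ∷ ys) = (x ++ y) ∷ zipLevels xs ys

zipLevels-assoc : ∀ {A : Set} (xs ys zs : List (List A)) →
  zipLevels (zipLevels xs ys) zs ≡ zipLevels xs (zipLevels ys zs)
zipLevels-assoc [] ys zs = refl
zipLevels-assoc (x ∷ xs) [] zs = refl
zipLevels-assoc (x ∷ xs) (y ∷ ys) [] = refl
zipLevels-assoc (x ∷ xs) (y ∷ ys) (z ∷ zs) = cong₂ _∷_ (List.++-assoc x y z) (zipLevels-assoc xs ys zs)

map-zipLevels : ∀ {A : Set} (f : A → ℕ) xs ys →
  map (map f) (zipLevels xs ys) ≡ zipLong (map (map f) xs) (map (map f) ys)
map-zipLevels f [] ys = refl
map-zipLevels f (x ∷ xs) [] = refl
map-zipLevels f (x ∷ xs) (y ∷ ys) = cong₂ _∷_ (map-++ f x y) (map-zipLevels f xs ys)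

concatMap-zipLevels-↭ : ∀ {A B : Set} (f : List A → List B) → (∀ x y → f (x ++ y) ≡ f x ++ f y) →
  ∀ xs ys → concatMap f (zipLevels xs ys) ↭ concatMap f xs ++ concatMap f ys
concatMap-zipLevels-↭ f f-++ [] ys = ↭-refl
concatMap-zipLevels-↭ f f-++ (x ∷ xs) [] = ↭-sym (++-identityʳ (concatMap f (x ∷ xs)))
concatMap-zipLevels-↭ f f-++ (x ∷ xs) (y ∷ ys) = begin
  f (x ++ y) ++ concatMap f (zipLevels xs ys)         ≡⟨ cong (_++ _) (f-++ x y) ⟩
  (f x ++ f y) ++ concatMap f (zipLevels xs ys)       ↭⟨ ++⁺ˡ (f x ++ f y) (concatMap-zipLevels-↭ f f-++ xs ys) ⟩
  (f x ++ f y) ++ (concatMap f xs ++ concatMap f ys)  ↭⟨ ++-interchange-↭ (f x) (f y) _ _ ⟩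
  (f x ++ concatMap f xs) ++ (f y ++ concatMap f ys)  ∎
  where open PermutationReasoning

mutual
  levelsᵣ : Rose → List (List Rose)
  levelsᵣ (node cs) = [ node cs ] ∷ levelsᶠ cs

  levelsᶠ : List Rose → List (List Rose)
  levelsᶠ [] = []
  levelsᶠ (t ∷ ts) = zipLevels (levelsᵣ t) (levelsᶠ ts)

nextLevel : List Rose → List Rose
nextLevel = concatMap children

levelsᶠ-++ : ∀ F G → levelsᶠ (F ++ G) ≡ zipLevels (levelsᶠ F) (levelsᶠ G)
levelsᶠ-++ [] G = refl
levelsᶠ-++ (t ∷ F) G =
  trans (cong (zipLevels (levelsᵣ t)) (levelsᶠ-++ F G)) (sym (zipLevels-assoc (levelsᵣ t) _ _))

levelsᶠ-∷ : ∀ t ts → levelsᶠ (t ∷ ts) ≡ (t ∷ ts) ∷ levelsᶠ (nextLevel (t ∷ ts))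
levelsᶠ-∷ (node cs) [] = cong (λ F → [ node cs ] ∷ levelsᶠ F) (sym (List.++-identityʳ cs))
levelsᶠ-∷ (node cs) (t ∷ ts) rewrite levelsᶠ-∷ t ts =
  cong ((node cs ∷ t ∷ ts) ∷_) (sym (levelsᶠ-++ cs (nextLevel (t ∷ ts))))

degreeLevels : List Rose → List (List ℕ)
degreeLevels F = map (map degN) (levelsᶠ F)

mutual
  levelsR≡degreeLevels : ∀ t → levelsR t ≡ map (map degN) (levelsᵣ t)
  levelsR≡degreeLevels (node cs) = cong ([ suc (length cs) ] ∷_) (levelsF≡degreeLevels cs)

  levelsF≡degreeLevels : ∀ F → levelsF F ≡ degreeLevels F
  levelsF≡degreeLevels [] = refl
  levelsF≡degreeLevels (t ∷ ts) = trans (cong₂ zipLong (levelsR≡degreeLevels t) (levelsF≡degreeLevels ts))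
                                        (sym (map-zipLevels degN (levelsᵣ t) (levelsᶠ ts)))

zipLong-levelsF : ∀ F G → zipLong (levelsF F) (levelsF G) ≡ degreeLevels (F ++ G)
zipLong-levelsF F G = begin
  zipLong (levelsF F) (levelsF G)
    ≡⟨ cong₂ zipLong (levelsF≡degreeLevels F) (levelsF≡degreeLevels G) ⟩
  zipLong (degreeLevels F) (degreeLevels G)
    ≡⟨ map-zipLevels degN (levelsᶠ F) (levelsᶠ G) ⟨
  map (map degN) (zipLevels (levelsᶠ F) (levelsᶠ G))
    ≡⟨ cong (map (map degN)) (levelsᶠ-++ F G) ⟨
  degreeLevels (F ++ G)
    ∎
  where open ≡-Reasoning

topEdges : ℕ → List Rose → Pairs
topEdges d F = map (λ t → d , degN t) F

childEdges : List Rose → Pairs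
childEdges = concatMap λ t → topEdges (degN t) (children t)

edgesBelow : List Rose → Pairs
edgesBelow F = concatMap childEdges (levelsᶠ F)

edgesBelow-++ : ∀ F G → edgesBelow (F ++ G) ↭ edgesBelow F ++ edgesBelow G
edgesBelow-++ F G =
  subst (_↭ edgesBelow F ++ edgesBelow G) (cong (concatMap childEdges) (sym (levelsᶠ-++ F G)))
  (concatMap-zipLevels-↭ childEdges (List.concatMap-++ _) (levelsᶠ F) (levelsᶠ G))

edgesBelow-unfold : ∀ F → edgesBelow F ≡ childEdges F ++ edgesBelow (nextLevel F)
edgesBelow-unfold [] = refl
edgesBelow-unfold (t ∷ ts) = cong (concatMap childEdges) (levelsᶠ-∷ t ts)

-- edgesF lists the edges depth first, edgesBelow level by level.
edgesF-↭ : ∀ d F → edgesF d F ↭ map sombor (topEdges d F ++ edgesBelow F)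
edgesF-↭ d [] = ↭-refl
edgesF-↭ d (node cs ∷ ts) = prep (sombor (d , e)) (begin
  edgesF e cs ++ edgesF d ts                                 ↭⟨ ++⁺ (edgesF-↭ e cs) (edgesF-↭ d ts) ⟩
  map sombor (A ++ B) ++ map sombor (C ++ D)                  ≡⟨ map-++ sombor (A ++ B) (C ++ D) ⟨
  map sombor ((A ++ B) ++ (C ++ D))                          ↭⟨ map⁺ sombor regroup ⟩
  map sombor (C ++ edgesBelow (node cs ∷ ts))                ∎)
  where
  open PermutationReasoning
  e = suc (length cs)
  A = topEdges e cs
  B = edgesBelow cs
  C = topEdges d ts
  D = edgesBelow ts
  regroup : (A ++ B) ++ (C ++ D) ↭ C ++ edgesBelow (node cs ∷ ts)
  regroup = begin
    (A ++ B) ++ (C ++ D)              ↭⟨ shifts (A ++ B) C ⟩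
    C ++ ((A ++ B) ++ D)              ≡⟨ cong (λ A′ → C ++ ((A′ ++ B) ++ D)) (List.++-identityʳ A) ⟨
    C ++ (((A ++ []) ++ B) ++ D)      ↭⟨ ++⁺ˡ C (↭-sym (edgesBelow-++ [ node cs ] ts)) ⟩
    C ++ edgesBelow (node cs ∷ ts)    ∎

map-proj₁-topEdges : ∀ d F → map proj₁ (topEdges d F) ≡ replicate (length F) d
map-proj₁-topEdges d [] = refl
map-proj₁-topEdges d (t ∷ F) = cong (d ∷_) (map-proj₁-topEdges d F)

map-proj₂-topEdges : ∀ d F → map proj₂ (topEdges d F) ≡ map degN F
map-proj₂-topEdges d F = sym (List.map-∘ F)

parentDegrees : List ℕ → List ℕ
parentDegrees = concatMap λ d → replicate (d ∸ 1) d

map-proj₁-childEdges : ∀ X → map proj₁ (childEdges X) ≡ parentDegrees (map degN X)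
map-proj₁-childEdges [] = refl
map-proj₁-childEdges (node cs ∷ ts) = trans (map-++ proj₁ (topEdges (suc (length cs)) cs) _)
  (cong₂ _++_ (map-proj₁-topEdges _ cs) (map-proj₁-childEdges ts))

map-proj₂-childEdges : ∀ X → map proj₂ (childEdges X) ≡ map degN (nextLevel X)
map-proj₂-childEdges [] = refl
map-proj₂-childEdges (node cs ∷ ts) = begin
  map proj₂ (topEdges (suc (length cs)) cs ++ childEdges ts)         ≡⟨ map-++ proj₂ (topEdges _ cs) _ ⟩
  map proj₂ (topEdges (suc (length cs)) cs) ++ map proj₂ (childEdges ts)
    ≡⟨ cong₂ _++_ (map-proj₂-topEdges _ cs) (map-proj₂-childEdges ts) ⟩
  map degN cs ++ map degN (nextLevel ts)                              ≡⟨ map-++ degN cs _ ⟨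
  map degN (cs ++ nextLevel ts)                                       ∎
  where open ≡-Reasoning

replicate-nonincreasing : ∀ n d → Nonincreasing (replicate n d)
replicate-nonincreasing zero d = []
replicate-nonincreasing (suc n) d = All.replicate⁺ n ≤-refl ∷ replicate-nonincreasing n d

parentDegrees-all : ∀ {P : ℕ → Set} {ds} → All P ds → All P (parentDegrees ds)
parentDegrees-all [] = []
parentDegrees-all {ds = d ∷ _} (pd ∷ pds) = All.++⁺ (All.replicate⁺ (d ∸ 1) pd) (parentDegrees-all pds)

parentDegrees-nonincreasing : ∀ {ds} → Nonincreasing ds → Nonincreasing (parentDegrees ds)
parentDegrees-nonincreasing [] = []
parentDegrees-nonincreasing {d ∷ _} (d≥ds ∷ ds↓) =
  AllPairsₚ.++⁺ (replicate-nonincreasing (d ∸ 1) d) (parentDegrees-nonincreasing ds↓)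
    (All.replicate⁺ (d ∸ 1) (parentDegrees-all d≥ds))

sum-degrees∸1 : ∀ X → sum (map (_∸ 1) (map degN X)) ≡ length (nextLevel X)
sum-degrees∸1 [] = refl
sum-degrees∸1 (node cs ∷ ts) = trans (cong (length cs +_) (sum-degrees∸1 ts)) (sym (List.length-++ cs))

degN-positive : ∀ X → All (1 ≤_) (map degN X)
degN-positive [] = []
degN-positive (node _ ∷ X) = s≤s z≤n ∷ degN-positive X

take-++-take-drop : ∀ {A : Set} m n (xs : List A) → take m xs ++ take n (drop m xs) ≡ take (m + n) xs
take-++-take-drop zero n xs = refl
take-++-take-drop (suc m) n [] = List.take-[] n
take-++-take-drop (suc m) n (x ∷ xs) = cong (x ∷_) (take-++-take-drop m n xs)

nextLevel-chunk : ∀ cs ts → nextLevel (chunk cs ts) ≡ take (sum cs) ts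
nextLevel-chunk [] ts = refl
nextLevel-chunk (c ∷ cs) ts =
  trans (cong (take c ts ++_) (nextLevel-chunk cs (drop c ts))) (take-++-take-drop c (sum cs) ts)

degN-chunk : ∀ ds ts → All (1 ≤_) ds → sum (map (_∸ 1) ds) ≤ length ts →
  map degN (chunk (map (_∸ 1) ds) ts) ≡ ds
degN-chunk [] ts [] _ = refl
degN-chunk (suc d ∷ ds) ts (_ ∷ ds≥1) fits = cong₂ _∷_
  (cong suc (trans (List.length-take d ts) (m≤n⇒m⊓n≡m (m+n≤o⇒m≤o d fits))))
  (degN-chunk ds (drop d ts) ds≥1 (subst (_ ≤_) (sym (List.length-drop d ts))
    (m+n≤o⇒m≤o∸n _ (subst (_≤ length ts) (+-comm d _) fits))))

childEdges-sortedRearrangement : ∀ {X Y} →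
  map degN Y ↭ map degN X → Nonincreasing (map degN Y) →
  map degN (nextLevel Y) ↭ map degN (nextLevel X) → Nonincreasing (map degN (nextLevel Y)) →
  SortedRearrangement (childEdges X) (childEdges Y)
childEdges-sortedRearrangement {X} {Y} Y↭X Y↓ Y′↭X′ Y′↓ = record
  { fst-↭ = subst₂ _↭_ (sym (map-proj₁-childEdges X)) (sym (map-proj₁-childEdges Y))
              (concatMap-↭ _ (↭-sym Y↭X))
  ; snd-↭ = subst₂ _↭_ (sym (map-proj₂-childEdges X)) (sym (map-proj₂-childEdges Y)) (↭-sym Y′↭X′)
  ; fst-nonincreasing = subst Nonincreasing (sym (map-proj₁-childEdges Y)) (parentDegrees-nonincreasing Y↓)
  ; snd-nonincreasing = subst Nonincreasing (sym (map-proj₂-childEdges Y)) Y′↓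
  }

record GreedyBound (X Y : List Rose) : Set where
  field
    degrees-↭ : map degN Y ↭ map degN X
    degrees-nonincreasing : Nonincreasing (map degN Y)
    edgesBelow-≥√ : map sombor (edgesBelow X) ≥√ map sombor (edgesBelow Y)

open GreedyBound

GreedyBound-length : ∀ {X Y} → GreedyBound X Y → length Y ≡ length X
GreedyBound-length {X} {Y} g = begin
  length Y             ≡⟨ List.length-map degN Y ⟨
  length (map degN Y)  ≡⟨ ↭-length (degrees-↭ g) ⟩
  length (map degN X)  ≡⟨ List.length-map degN X ⟩
  length X             ∎
  where open ≡-Reasoning

GreedyBound-level : ∀ {X Y} → map degN Y ↭ map degN X → Nonincreasing (map degN Y) →
  GreedyBound (nextLevel X) (nextLevel Y) → GreedyBound X Y
GreedyBound-level {X} {Y} Y↭X Y↓ g = record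
  { degrees-↭ = Y↭X
  ; degrees-nonincreasing = Y↓
  ; edgesBelow-≥√ = subst₂ _≥√_ (split X) (split Y)
      (≥√-++ (sombor-rearrangement (childEdges Y) layer) (edgesBelow-≥√ g))
  }
  where
  layer : SortedRearrangement (childEdges X) (childEdges Y)
  layer = childEdges-sortedRearrangement Y↭X Y↓ (degrees-↭ g) (degrees-nonincreasing g)
  split : ∀ F → map sombor (childEdges F) ++ map sombor (edgesBelow (nextLevel F)) ≡ map sombor (edgesBelow F)
  split F = trans (sym (map-++ sombor (childEdges F) _)) (cong (map sombor) (sym (edgesBelow-unfold F)))

GreedyBound-chunk : ∀ X {Y′} → GreedyBound (nextLevel X) Y′ →
  GreedyBound X (chunk (map (_∸ 1) (sortDesc (map degN X))) Y′)
GreedyBound-chunk X {Y′} g′ = GreedyBound-level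
  (subst (_↭ map degN X) (sym degN-Y) (sortDesc-↭ (map degN X)))
  (subst Nonincreasing (sym degN-Y) (sortDesc-nonincreasing (map degN X)))
  (subst (GreedyBound (nextLevel X)) (sym nextLevel-Y) g′)
  where
  V = sortDesc (map degN X)
  Y = chunk (map (_∸ 1) V) Y′
  sum-fits : sum (map (_∸ 1) V) ≡ length Y′
  sum-fits = begin
    sum (map (_∸ 1) V)                  ≡⟨ sum-↭ (map⁺ (_∸ 1) (sortDesc-↭ (map degN X))) ⟩
    sum (map (_∸ 1) (map degN X))       ≡⟨ sum-degrees∸1 X ⟩
    length (nextLevel X)                ≡⟨ GreedyBound-length g′ ⟨
    length Y′                           ∎
    where open ≡-Reasoning
  degN-Y : map degN Y ≡ V
  degN-Y = degN-chunk V Y′ (All-resp-↭ (↭-sym (sortDesc-↭ _)) (degN-positive X)) (≤-reflexive sum-fits)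
  nextLevel-Y : nextLevel Y ≡ Y′
  nextLevel-Y = trans (nextLevel-chunk (map (_∸ 1) V) Y′) (List.take-all _ Y′ (≤-reflexive (sym sum-fits)))

greedyForest : List Rose → List Rose
greedyForest X = buildLevels (map sortDesc (degreeLevels X))

greedyForest-bound : ∀ X → GreedyBound X (greedyForest X)
greedyForest-bound X = by-levels (levelsᶠ X) X refl
  where
  by-levels : ∀ Ls X → levelsᶠ X ≡ Ls → GreedyBound X (greedyForest X)
  by-levels _ [] _ = record
    { degrees-↭ = ↭-refl ; degrees-nonincreasing = [] ; edgesBelow-≥√ = ≥√-refl [] }
  by-levels [] (t ∷ ts) eq with () ← trans (sym (levelsᶠ-∷ t ts)) eq
  by-levels (_ ∷ Ls) (t ∷ ts) eq rewrite levelsᶠ-∷ t ts =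
    GreedyBound-chunk (t ∷ ts) (by-levels Ls (nextLevel (t ∷ ts)) (List.∷-injectiveʳ eq))

map-proj₁-topEdges-++ : ∀ da db F G →
  map proj₁ (topEdges da F ++ topEdges db G) ≡ replicate (length F) da ++ replicate (length G) db
map-proj₁-topEdges-++ da db F G =
  trans (map-++ proj₁ (topEdges da F) _) (cong₂ _++_ (map-proj₁-topEdges da F) (map-proj₁-topEdges db G))

map-proj₂-topEdges-++ : ∀ da db F G → map proj₂ (topEdges da F ++ topEdges db G) ≡ map degN (F ++ G)
map-proj₂-topEdges-++ da db F G = begin
  map proj₂ (topEdges da F ++ topEdges db G)              ≡⟨ map-++ proj₂ (topEdges da F) _ ⟩
  map proj₂ (topEdges da F) ++ map proj₂ (topEdges db G)
    ≡⟨ cong₂ _++_ (map-proj₂-topEdges da F) (map-proj₂-topEdges db G) ⟩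
  map degN F ++ map degN G                                ≡⟨ map-++ degN F G ⟨
  map degN (F ++ G)                                       ∎
  where open ≡-Reasoning

topEdges-sortedRearrangement : ∀ {da db a b Ya Yb} →
  db ≤ da → length Ya ≡ length a → length Yb ≡ length b → GreedyBound (a ++ b) (Ya ++ Yb) →
  SortedRearrangement (topEdges da a ++ topEdges db b) (topEdges da Ya ++ topEdges db Yb)
topEdges-sortedRearrangement {da} {db} {a} {b} {Ya} {Yb} db≤da |Ya| |Yb| g = record
  { fst-↭ = ↭-reflexive (trans (map-proj₁-topEdges-++ da db a b) (sym fst-Y))
  ; snd-↭ = subst₂ _↭_ (sym (map-proj₂-topEdges-++ da db a b)) (sym (map-proj₂-topEdges-++ da db Ya Yb))
              (↭-sym (degrees-↭ g))
  ; fst-nonincreasing = subst Nonincreasing (sym fst-Y)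
      (AllPairsₚ.++⁺ (replicate-nonincreasing _ da) (replicate-nonincreasing _ db)
        (All.replicate⁺ (length a) (All.replicate⁺ (length b) db≤da)))
  ; snd-nonincreasing = subst Nonincreasing (sym (map-proj₂-topEdges-++ da db Ya Yb)) (degrees-nonincreasing g)
  }
  where
  fst-Y : map proj₁ (topEdges da Ya ++ topEdges db Yb) ≡ replicate (length a) da ++ replicate (length b) db
  fst-Y = trans (map-proj₁-topEdges-++ da db Ya Yb)
                (cong₂ (λ m n → replicate m da ++ replicate n db) |Ya| |Yb|)

edgesF-++-↭ : ∀ da db F G → edgesF da F ++ edgesF db G ↭
  map sombor (topEdges da F ++ topEdges db G) ++ map sombor (edgesBelow (F ++ G))
edgesF-++-↭ da db F G = begin
  edgesF da F ++ edgesF db G                                 ↭⟨ ++⁺ (edgesF-↭ da F) (edgesF-↭ db G) ⟩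
  map sombor (TF ++ BF) ++ map sombor (TG ++ BG)             ≡⟨ map-++ sombor (TF ++ BF) (TG ++ BG) ⟨
  map sombor ((TF ++ BF) ++ (TG ++ BG))                      ↭⟨ map⁺ sombor (++-interchange-↭ TF BF TG BG) ⟩
  map sombor ((TF ++ TG) ++ (BF ++ BG))                      ↭⟨ map⁺ sombor (++⁺ˡ (TF ++ TG) below-++) ⟩
  map sombor ((TF ++ TG) ++ edgesBelow (F ++ G))             ≡⟨ map-++ sombor (TF ++ TG) _ ⟩
  map sombor (TF ++ TG) ++ map sombor (edgesBelow (F ++ G))  ∎
  where
  open PermutationReasoning
  TF = topEdges da F
  TG = topEdges db G
  BF = edgesBelow F
  BG = edgesBelow G
  below-++ = ↭-sym (edgesBelow-++ F G)

edgesF-++-≥√ : ∀ {da db a b Ya Yb} → db ≤ da → length Ya ≡ length a → length Yb ≡ length b →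
  GreedyBound (a ++ b) (Ya ++ Yb) → edgesF da a ++ edgesF db b ≥√ edgesF da Ya ++ edgesF db Yb
edgesF-++-≥√ {da} {db} {a} {b} {Ya} {Yb} db≤da |Ya| |Yb| g =
  ≥√-resp-↭ (↭-sym (edgesF-++-↭ da db a b)) (↭-sym (edgesF-++-↭ da db Ya Yb))
    (≥√-++ (sombor-rearrangement _ (topEdges-sortedRearrangement {a = a} {b} {Ya} {Yb} db≤da |Ya| |Yb| g))
           (edgesBelow-≥√ g))

-- A vertex root is an edge root without the root edge and with an empty second group.
vertexRooted-≥√ : ∀ cs F → GreedyBound cs F →
  soTerms (vroot (node cs)) ≥√ soTerms (vroot (node (take (length cs) F)))
vertexRooted-≥√ cs F g rewrite List.take-all (length cs) F (≤-reflexive (GreedyBound-length g))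
                              | GreedyBound-length g =
  subst₂ _≥√_ (List.++-identityʳ _) (List.++-identityʳ _)
    (edgesF-++-≥√ {a = cs} {b = []} {F} {[]} z≤n (GreedyBound-length g) refl
      (subst₂ GreedyBound (sym (List.++-identityʳ cs)) (sym (List.++-identityʳ F)) g))

edgeRooted-≥√ : ∀ {a b Ya Yb} →
  length b ≤ length a → length Ya ≡ length a → length Yb ≡ length b → GreedyBound (a ++ b) (Ya ++ Yb) →
  soTerms (eroot (node a) (node b)) ≥√ soTerms (eroot (node Ya) (node Yb))
edgeRooted-≥√ {a} {b} {Ya} {Yb} b≤a |Ya| |Yb| g rewrite |Ya| | |Yb| =
  ≥√-∷ ≤-refl (edgesF-++-≥√ {a = a} {b} {Ya} {Yb} (s≤s b≤a) |Ya| |Yb| g)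

edgeRooted-split-≥√ : ∀ a b F → length b ≤ length a → GreedyBound (a ++ b) F →
  soTerms (eroot (node a) (node b))
    ≥√ soTerms (eroot (node (take (length a) F)) (node (take (length b) (drop (length a) F))))
edgeRooted-split-≥√ a b F b≤a g =
  edgeRooted-≥√ {a} {b} {Ya} {Yb} b≤a |Ya| |Yb| (subst (GreedyBound (a ++ b)) (sym Ya++Yb≡F) g)
  where
  Ya = take (length a) F
  Yb = take (length b) (drop (length a) F)
  |F| : length F ≡ length a + length b
  |F| = trans (GreedyBound-length g) (List.length-++ a)
  |Ya| : length Ya ≡ length a
  |Ya| = trans (List.length-take (length a) F) (m≤n⇒m⊓n≡m (≤-trans (m≤m+n _ _) (≤-reflexive (sym |F|))))
  |Yb| : length Yb ≡ length b
  |Yb| = trans (List.length-take (length b) _) (m≤n⇒m⊓n≡m (≤-reflexive (sym (begin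
    length (drop (length a) F)     ≡⟨ List.length-drop (length a) F ⟩
    length F ∸ length a            ≡⟨ cong (_∸ length a) |F| ⟩
    length a + length b ∸ length a ≡⟨ m+n∸m≡n (length a) (length b) ⟩
    length b                       ∎))))
    where open ≡-Reasoning
  Ya++Yb≡F : Ya ++ Yb ≡ F
  Ya++Yb≡F = trans (take-++-take-drop (length a) (length b) F) (List.take-all _ F (≤-reflexive |F|))

GreedyBound-++-comm : ∀ a b {Y} → GreedyBound (a ++ b) Y → GreedyBound (b ++ a) Y
GreedyBound-++-comm a b g = record
  { degrees-↭ = ↭-trans (degrees-↭ g) (map⁺ degN (++-comm a b))
  ; degrees-nonincreasing = degrees-nonincreasing g
  ; edgesBelow-≥√ = ≥√-resp-↭ (map⁺ sombor below-comm) ↭-refl (edgesBelow-≥√ g)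
  }
  where
  open PermutationReasoning
  below-comm : edgesBelow (a ++ b) ↭ edgesBelow (b ++ a)
  below-comm = begin
    edgesBelow (a ++ b)              ↭⟨ edgesBelow-++ a b ⟩
    edgesBelow a ++ edgesBelow b     ↭⟨ ++-comm (edgesBelow a) (edgesBelow b) ⟩
    edgesBelow b ++ edgesBelow a     ↭⟨ edgesBelow-++ b a ⟨
    edgesBelow (b ++ a)              ∎

soTerms-eroot-↭ : ∀ x y → soTerms (eroot x y) ↭ soTerms (eroot y x)
soTerms-eroot-↭ (node a) (node b) = ↭-trans
  (↭-reflexive (cong (_∷ edgesF (suc (length a)) a ++ edgesF (suc (length b)) b)
                      (+-comm (sq (suc (length a))) (sq (suc (length b))))))
  (prep (sq (suc (length b)) + sq (suc (length a)))
        (++-comm (edgesF (suc (length a)) a) (edgesF (suc (length b)) b)))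

theorem3p16 : (T : RTree) → SO-≥ T (greedy (levDeg T))
theorem3p16 (vroot (node cs)) rewrite levelsF≡degreeLevels cs =
  holds (vertexRooted-≥√ cs (greedyForest cs) (greedyForest-bound cs))
theorem3p16 (eroot (node a) (node b)) rewrite zipLong-levelsF a b
  with does (suc (length b) ≤? suc (length a)) | proof (suc (length b) ≤? suc (length a))
... | true | ofʸ 1+b≤1+a =
  holds (edgeRooted-split-≥√ a b _ (s≤s⁻¹ 1+b≤1+a) (greedyForest-bound (a ++ b)))
... | false | ofⁿ 1+b≰1+a =
  holds (≥√-resp-↭ (soTerms-eroot-↭ (node b) (node a)) ↭-refl
    (edgeRooted-split-≥√ b a _ (s≤s⁻¹ (<⇒≤ (≰⇒> 1+b≰1+a)))
      (GreedyBound-++-comm a b (greedyForest-bound (a ++ b)))))
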